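{- Let $\mathcal{P}$ be a finite chiral $n$-polytope, and let $\mathcal{Q}$ be a finite directly regular $n$-polytope whose rotation group $\Gamma^+(\mathcal{Q})$ is simple. If $X(\mathcal{P})$ is not isomorphic to $\Gamma^+(\mathcal{Q})$, then $X(\mathcal{P}\diamond\mathcal{Q})=X(\mathcal{P})$ (in particular $X(\mathcal{P}\diamond\mathcal{Q})\cong X(\mathcal{P})$).
   Context: All polytopes are abstract polytopes. A regular polytope is directly regular if its rotation group $\Gamma^+(\mathcal{P})$, generated by $\sigma_i=\rho_{i-1}\rho_i$ ($\rho_0,\dots,\rho_{n-1}$ the standard generating involutions relative to a base flag), has index $2$ in the automorphism group. A polytope is chiral if its automorphism group has two orbits on flags, adjacent flags lying in distinct orbits; then $\Gamma^+(\mathcal{P})$ is the full automorphism group, generated by standard rotations $\sigma_1,\dots,\sigma_{n-1}$. Let $W^+=\langle \sigma_1,\dots,\sigma_{n-1}\mid (\sigma_i\cdots\sigma_j)^2=1,\ 1\le i<j\le n-1\rangle$; each such $\Gamma^+(\mathcal{P})$ equals $W^+/M$ for a normal subgroup $M$, generators corresponding. Let $w\mapsto\overline{w}$ be the automorphism of $W^+$ with $\sigma_1\mapsto\sigma_1^{ -1}$, $\sigma_2\mapsto\sigma_1^2\sigma_2$, $\sigma_j\mapsto\sigma_j$ ($j\ge3$). Mix: if $\Gamma^+(\mathcal{P})=W^+/M$ and $\Gamma^+(\mathcal{Q})=W^+/K$, the mix $\mathcal{P}\diamond\mathcal{Q}$ is the (flag-connected pre-)polytope whose rotation group is the subgroup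 of $\Gamma^+(\mathcal{P})\times\Gamma^+(\mathcal{Q})$ generated by $(\sigma_i,\sigma_i')$, isomorphic to $W^+/(M\cap K)$. Chirality group: for rotation group $W^+/N$, $X=N\overline{N}/N$, the kernel of the natural epimorphism $W^+/N\to W^+/(N\overline N)$ (isomorphic to $N/(N\cap\overline N)$). -}

module Defs where

open import Data.Nat using (ℕ; suc; _≤?_; _<?_; _<_)
open import Data.Fin using (Fin; zero; suc; toℕ)
open import Data.Fin.Subset using (Subset; _∈_; _∩_)
open import Data.Bool using (Bool; true; false; not; if_then_else_)
open import Data.Product using (Σ; _×_; _,_; proj₁)
open import Data.Sum using (_⊎_)
open import Data.List using (List; []; _∷_; _++_; map; reverse; filter; concatMap; allFin)
open import Data.List.Relation.Unary.All using (All)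
open import Data.List.Relation.Unary.Any using (Any)
open import Relation.Nullary using (¬_)
open import Relation.Nullary.Decidable using (_×-dec_)

-- Words in the free group on σ₁ … σᵣ  (rank n = suc r).
-- The letter (k , true) is σ_{k+1}, (k , false) is σ_{k+1}⁻¹.

Letter : ℕ → Set
Letter r = Fin r × Bool

Word : ℕ → Set
Word r = List (Letter r)

invL : ∀ {r} → Letter r → Letter r
invL (k , b) = k , not b

invW : ∀ {r} → Word r → Word r
invW w = reverse (map invL w)

data _≈F_ {r : ℕ} : Word r → Word r → Set where
  ≈refl   : ∀ {w} → w ≈F w
  ≈sym    : ∀ {u v} → u ≈F v → v ≈F u
  ≈trans  : ∀ {u v w} → u ≈F v → v ≈F w → u ≈F w
  ≈cancel : ∀ u x v → (u ++ x ∷ invL x ∷ v) ≈F (u ++ v)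

record IsNormalSub {r : ℕ} (N : Word r → Set) : Set where
  field
    resp : ∀ {u v} → u ≈F v → N u → N v
    nil  : N []
    mul  : ∀ {u v} → N u → N v → N (u ++ v)
    inv  : ∀ {u} → N u → N (invW u)
    conj : ∀ g {u} → N u → N (g ++ u ++ invW g)

-- positive word σ_{lo+1} σ_{lo+2} ⋯ σ_{hi}  (Fin-indices k with lo ≤ k < hi)
range : ∀ {r} → ℕ → ℕ → Word r
range {r} lo hi =
  map (λ k → k , true) (filter (λ k → (lo ≤? toℕ k) ×-dec (toℕ k <? hi)) (allFin r))

-- defining relators of W⁺ : (σᵢ ⋯ σⱼ)² for 1 ≤ i < j ≤ n-1
relator : ∀ {r} → Fin r → Fin r → Word r
relator a b = range (toℕ a) (suc (toℕ b)) ++ range (toℕ a) (suc (toℕ b))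

ContainsRelators : ∀ {r} → (Word r → Set) → Set
ContainsRelators {r} N = ∀ (a b : Fin r) → toℕ a < toℕ b → N (relator a b)

-- N is a normal subgroup of W⁺ (pulled back to the free group): Γ⁺ = W⁺/N
IsRotSub : ∀ {r} → (Word r → Set) → Set
IsRotSub N = IsNormalSub N × ContainsRelators N

_∼[_]_ : ∀ {r} → Word r → (Word r → Set) → Word r → Set
u ∼[ N ] v = N (u ++ invW v)

-- the automorphism w ↦ w̄ :  σ₁ ↦ σ₁⁻¹, σ₂ ↦ σ₁²σ₂, σⱼ ↦ σⱼ (j ≥ 3)

barPos : ∀ {r} → Fin r → Word r
barPos zero = (zero , false) ∷ []
barPos (suc zero) = (zero , true) ∷ (zero , true) ∷ (suc zero , true) ∷ []
barPos k@(suc (suc _)) = (k , true) ∷ []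

barL : ∀ {r} → Letter r → Word r
barL (k , true)  = barPos k
barL (k , false) = invW (barPos k)

barW : ∀ {r} → Word r → Word r
barW w = concatMap barL w

-- N̄ = image of N under the bar automorphism (an involution)
Bar : ∀ {r} → (Word r → Set) → Word r → Set
Bar N w = N (barW w)

Meet : ∀ {r} → (Word r → Set) → (Word r → Set) → Word r → Set
Meet N K w = N w × K w

Prod : ∀ {r} → (Word r → Set) → (Word r → Set) → Word r → Set
Prod {r} N M w = Σ (Word r) λ a → Σ (Word r) λ b → N a × M b × (w ≈F (a ++ b))

-- chirality group X = N N̄ / N  (as the set of representatives in N N̄)
ChiralityGroup : ∀ {r} → (Word r → Set) → Word r → Set
ChiralityGroup N = Prod N (Bar N)

FiniteQuot : ∀ {r} → (Word r → Set) → Set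
FiniteQuot {r} N = Σ (List (Word r)) λ L → ∀ w → Any (λ v → w ∼[ N ] v) L

SimpleQuot : ∀ {r} → (Word r → Set) → Set₁
SimpleQuot {r} K =
  (¬ (∀ w → K w)) ×
  (∀ (L : Word r → Set) → IsNormalSub L → (∀ w → K w → L w) →
     (∀ w → L w → K w) ⊎ (∀ w → L w))

-- intersection condition (Schulte–Weiss) for Γ⁺ = W⁺/N:
-- τ_{i,j} = σ_{i+1}⋯σ_j (0 ≤ i < j ≤ n-1), Γ_I = ⟨τ_{i,j} | i,j ∈ I⟩,
-- Γ_I ∩ Γ_J = Γ_{I∩J}.  (τ's involving -1 or n are trivial and omitted.)

TauLetter : ℕ → Set
TauLetter r = Fin (suc r) × Fin (suc r) × Bool

tau : ∀ {r} → Fin (suc r) → Fin (suc r) → Word r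
tau i j = range (toℕ i) (toℕ j)

expandTau : ∀ {r} → List (TauLetter r) → Word r
expandTau = concatMap (λ { (i , j , b) → if b then tau i j else invW (tau i j) })

AllowedTau : ∀ {r} → Subset (suc r) → TauLetter r → Set
AllowedTau I (i , j , _) = i ∈ I × j ∈ I × toℕ i < toℕ j

InGen : ∀ {r} → (Word r → Set) → Subset (suc r) → Word r → Set
InGen {r} N I w = Σ (List (TauLetter r)) λ u → All (AllowedTau I) u × (w ∼[ N ] expandTau u)

IntersectionProperty : ∀ {r} → (Word r → Set) → Set
IntersectionProperty {r} N =
  ∀ (I J : Subset (suc r)) w → InGen N I w → InGen N J w → InGen N (I ∩ J) w

-- chiral / directly regular polytopes of rank n = suc r, via Γ⁺ = W⁺/N

BarInvariant : ∀ {r} → (Word r → Set) → Set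
BarInvariant N = ∀ w → (N w → N (barW w)) × (N (barW w) → N w)

IsChiralRot : ∀ {r} → (Word r → Set) → Set
IsChiralRot N = IsRotSub N × IntersectionProperty N × (¬ BarInvariant N)

IsDirRegRot : ∀ {r} → (Word r → Set) → Set
IsDirRegRot K = IsRotSub K × IntersectionProperty K × BarInvariant K

-- group isomorphism between subgroup S₁N₁/N₁ of W⁺/N₁ and S₂N₂/N₂ of W⁺/N₂
record SubQuotIso {r : ℕ} (S₁ N₁ S₂ N₂ : Word r → Set) : Set where
  field
    f      : Σ (Word r) S₁ → Word r
    f-in   : ∀ x → S₂ (f x)
    f-wd   : ∀ x y → proj₁ x ∼[ N₁ ] proj₁ y → f x ∼[ N₂ ] f y
    f-inj  : ∀ x y → f x ∼[ N₂ ] f y → proj₁ x ∼[ N₁ ] proj₁ y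
    f-hom  : ∀ x y z → proj₁ z ∼[ N₁ ] (proj₁ x ++ proj₁ y) → f z ∼[ N₂ ] (f x ++ f y)
    f-surj : ∀ u → S₂ u → Σ (Σ (Word r) S₁) λ x → f x ∼[ N₂ ] u

-- X(P ◇ Q) = X(P): the natural projection Γ⁺(P◇Q) = W⁺/(N∩K) → W⁺/N = Γ⁺(P)
-- restricts to a bijection X(P◇Q) → X(P).
MixChiralityEq : ∀ {r} → (Word r → Set) → (Word r → Set) → Set
MixChiralityEq {r} N K =
  (∀ w → ChiralityGroup (Meet N K) w → N w → Meet N K w) ×
  (∀ w → ChiralityGroup N w →
     Σ (Word r) λ v → ChiralityGroup (Meet N K) v × (v ∼[ N ] w))

-- Write Γ⁺(P) = W⁺/N and Γ⁺(Q) = W⁺/K, all subgroups being represented by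
-- predicates on words of the free group, and N̄ for the bar image of N.
-- Since K is bar-invariant, the chirality group (N∩K)(N̄∩K) of the mix lies
-- in K, so the projection X(P ◇ Q) → X(P) is injective.  For surjectivity it
-- suffices that every b ∈ N̄ is congruent modulo N to some c ∈ N̄ ∩ K.
-- Simplicity of W⁺/K says that KA is K or W⁺ for every normal A.  If KN = K
-- or KN̄ = K then N̄ ⊆ K and c = b works; if K(N∩N̄) = W⁺, write b = km with
-- m ∈ N∩N̄ and take c = m⁻¹b.  In the remaining case KN = KN̄ = W⁺ and
-- N∩N̄ ⊆ K, the commutator [N,N̄] ⊆ N∩N̄ forces W⁺/K to be abelian, which is
-- impossible: in rank 2 every normal subgroup of the cyclic group W⁺ is
-- bar-invariant (P would not be chiral), and in rank ≥ 3 the relators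
-- (σⱼσⱼ₊₁)² and the intersection property force every σⱼ into K.
module Submission where

open import Defs
open import Data.Nat using (ℕ; zero; suc; _≤_; _<_; s≤s; _≤?_; _<?_)
open import Data.Nat.Properties using (<-irrefl; <-trans; <⇒≢; n<1+n)
open import Data.Fin using (Fin; zero; suc; toℕ; inject₁)
open import Data.Fin.Properties using (toℕ-inject₁)
open import Data.Fin.Subset using (Subset; _∈_; _∩_; _∪_; ⁅_⁆)
open import Data.Fin.Subset.Properties using (x∈⁅x⁆; x∈⁅y⁆⇒x≡y; x∈p∩q⁻; x∈p∪q⁻; x∈p∪q⁺)
open import Data.Bool using (Bool; true; false; if_then_else_)
open import Data.Bool.Properties using (not-involutive)
open import Data.Product using (Σ; _×_; _,_; proj₁; proj₂)
open import Data.Sum using (_⊎_; inj₁; inj₂)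
open import Data.Empty using (⊥-elim)
open import Data.Unit using (⊤)
open import Data.List using (List; []; _∷_; _++_; [_]; map; reverse; filter; tabulate; allFin)
open import Data.List.Properties
  using (++-monoid; ++-assoc; ++-identityʳ; map-++; reverse-++; reverse-map; reverse-involutive;
         map-∘; map-cong; map-id; concatMap-++; unfold-reverse; filter-accept; filter-reject; filter-none)
open import Data.List.Relation.Unary.All using ([]; _∷_; universal)
open import Data.List.Relation.Unary.All.Properties using (tabulate⁺; map⁺)
open import Function using (_∘_)
open import Relation.Nullary using (¬_; Dec; yes; no)
open import Relation.Nullary.Decidable using (_×-dec_)
open import Relation.Binary.Bundles using (Setoid)
open import Relation.Binary.PropositionalEquality
  using (_≡_; _≢_; refl; sym; trans; cong; cong₂; subst; subst₂; ≢-sym; module ≡-Reasoning)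
open import Tactic.MonoidSolver using (solve)
import Relation.Binary.Reasoning.Setoid

freeSetoid : ℕ → Setoid _ _
freeSetoid r = record
  { Carrier = Word r ; _≈_ = _≈F_
  ; isEquivalence = record { refl = ≈refl ; sym = ≈sym ; trans = ≈trans } }

module ≈F-Reasoning (r : ℕ) = Relation.Binary.Reasoning.Setoid (freeSetoid r)

module _ {r : ℕ} where

  invL-involutive : (x : Letter r) → invL (invL x) ≡ x
  invL-involutive (k , b) = cong (k ,_) (not-involutive b)

  invW-++ : (u v : Word r) → invW (u ++ v) ≡ invW v ++ invW u
  invW-++ u v = trans (cong reverse (map-++ invL u v)) (reverse-++ (map invL u) (map invL v))

  invW-involutive : (u : Word r) → invW (invW u) ≡ u
  invW-involutive u = begin
    reverse (map invL (reverse (map invL u))) ≡⟨ cong reverse (reverse-map invL (map invL u)) ⟩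
    reverse (reverse (map invL (map invL u))) ≡⟨ reverse-involutive _ ⟩
    map invL (map invL u)                     ≡⟨ map-∘ u ⟨
    map (invL ∘ invL) u                       ≡⟨ map-cong invL-involutive u ⟩
    map (λ x → x) u                           ≡⟨ map-id u ⟩
    u                                         ∎
    where open ≡-Reasoning

  ≡⇒≈F : {u v : Word r} → u ≡ v → u ≈F v
  ≡⇒≈F refl = ≈refl

  ≈F-prefix : (p : Word r) {u v : Word r} → u ≈F v → (p ++ u) ≈F (p ++ v)
  ≈F-prefix p ≈refl          = ≈refl
  ≈F-prefix p (≈sym e)       = ≈sym (≈F-prefix p e)
  ≈F-prefix p (≈trans e f)   = ≈trans (≈F-prefix p e) (≈F-prefix p f)
  ≈F-prefix p (≈cancel u x v) =
    ≈trans (≡⇒≈F (sym (++-assoc p u _)))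
           (≈trans (≈cancel (p ++ u) x v) (≡⇒≈F (++-assoc p u v)))

  ≈F-suffix : (q : Word r) {u v : Word r} → u ≈F v → (u ++ q) ≈F (v ++ q)
  ≈F-suffix q ≈refl          = ≈refl
  ≈F-suffix q (≈sym e)       = ≈sym (≈F-suffix q e)
  ≈F-suffix q (≈trans e f)   = ≈trans (≈F-suffix q e) (≈F-suffix q f)
  ≈F-suffix q (≈cancel u x v) =
    ≈trans (≡⇒≈F (++-assoc u (x ∷ invL x ∷ v) q))
           (≈trans (≈cancel u x (v ++ q)) (≡⇒≈F (sym (++-assoc u v q))))

  ≈F-++ : {u v u′ v′ : Word r} → u ≈F v → u′ ≈F v′ → (u ++ u′) ≈F (v ++ v′)
  ≈F-++ {v = v} {u′ = u′} e f = ≈trans (≈F-suffix u′ e) (≈F-prefix v f)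

  invW-cancelʳ : (u : Word r) → (u ++ invW u) ≈F []
  invW-cancelʳ []      = ≈refl
  invW-cancelʳ (x ∷ u) = begin
    x ∷ u ++ invW (x ∷ u)           ≡⟨ cong (λ z → x ∷ u ++ z) (invW-++ [ x ] u) ⟩
    x ∷ u ++ invW u ++ [ invL x ]   ≡⟨ cong (x ∷_) (++-assoc u (invW u) _) ⟨
    [ x ] ++ (u ++ invW u) ++ [ invL x ] ≈⟨ ≈F-prefix [ x ] (≈F-suffix [ invL x ] (invW-cancelʳ u)) ⟩
    x ∷ invL x ∷ []                 ≈⟨ ≈cancel [] x [] ⟩
    []                              ∎
    where open ≈F-Reasoning r

  invW-cancelˡ : (u : Word r) → (invW u ++ u) ≈F []
  invW-cancelˡ u =
    ≈trans (≡⇒≈F (cong (invW u ++_) (sym (invW-involutive u)))) (invW-cancelʳ (invW u))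

  ≈F-invW : {u v : Word r} → u ≈F v → invW u ≈F invW v
  ≈F-invW {u} {v} e = begin
    invW u                      ≡⟨ ++-identityʳ (invW u) ⟨
    invW u ++ []                ≈⟨ ≈F-prefix (invW u) (invW-cancelʳ v) ⟨
    invW u ++ v ++ invW v       ≈⟨ ≈F-prefix (invW u) (≈F-suffix (invW v) e) ⟨
    invW u ++ u ++ invW v       ≡⟨ ++-assoc (invW u) u (invW v) ⟨
    (invW u ++ u) ++ invW v     ≈⟨ ≈F-suffix (invW v) (invW-cancelˡ u) ⟩
    invW v                      ∎
    where open ≈F-Reasoning r

  ≈F-insert : (p v q : Word r) → (p ++ q) ≈F (p ++ (invW v ++ v) ++ q)
  ≈F-insert p v q = ≈F-prefix p (≈F-suffix q (≈sym (invW-cancelˡ v)))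

module Modulo {r : ℕ} (N : Word r → Set) (nN : IsNormalSub N) where
  open IsNormalSub nN

  infix 4 _∼_
  -- a record rather than a synonym, so that u and v are inferable
  record _∼_ (u v : Word r) : Set where
    constructor mk∼
    field witness : u ∼[ N ] v
  open _∼_ public

  ∼-refl : {u : Word r} → u ∼ u
  ∼-refl {u} = mk∼ (resp (≈sym (invW-cancelʳ u)) nil)

  ∼-sym : {u v : Word r} → u ∼ v → v ∼ u
  ∼-sym {u} {v} (mk∼ e) = mk∼ (subst N inverse (inv e))
    where
    inverse : invW (u ++ invW v) ≡ v ++ invW u
    inverse = trans (invW-++ u (invW v)) (cong (_++ invW u) (invW-involutive v))

  ∼-trans : {u v w : Word r} → u ∼ v → v ∼ w → u ∼ w
  ∼-trans {u} {v} {w} (mk∼ e) (mk∼ f) = mk∼ (resp cancelMiddle (mul e f))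
    where
    cancelMiddle : ((u ++ invW v) ++ (v ++ invW w)) ≈F (u ++ invW w)
    cancelMiddle = begin
      (u ++ invW v) ++ (v ++ invW w)  ≡⟨ solve (++-monoid (Letter r)) ⟩
      u ++ (invW v ++ v) ++ invW w    ≈⟨ ≈F-insert u v (invW w) ⟨
      u ++ invW w                     ∎
      where open ≈F-Reasoning r

  setoid : Setoid _ _
  setoid = record
    { Carrier = Word r ; _≈_ = _∼_
    ; isEquivalence = record { refl = ∼-refl ; sym = ∼-sym ; trans = ∼-trans } }

  module ∼-Reasoning = Relation.Binary.Reasoning.Setoid setoid

  ≈F⇒∼ : {u v : Word r} → u ≈F v → u ∼ v
  ≈F⇒∼ {u} {v} e = mk∼ (resp (≈F-suffix (invW v) (≈sym e)) (witness (∼-refl {v})))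

  ≡⇒∼ : {u v : Word r} → u ≡ v → u ∼ v
  ≡⇒∼ refl = ∼-refl

  -- ∼ is a congruence for concatenation; on the left this is normality
  ∼-prefix : (p : Word r) {u v : Word r} → u ∼ v → (p ++ u) ∼ (p ++ v)
  ∼-prefix p {u} {v} (mk∼ e) = mk∼ (subst N conjugate (conj p e))
    where
    conjugate : p ++ (u ++ invW v) ++ invW p ≡ (p ++ u) ++ invW (p ++ v)
    conjugate = begin
      p ++ (u ++ invW v) ++ invW p   ≡⟨ solve (++-monoid (Letter r)) ⟩
      (p ++ u) ++ invW v ++ invW p   ≡⟨ cong ((p ++ u) ++_) (invW-++ p v) ⟨
      (p ++ u) ++ invW (p ++ v)      ∎
      where open ≡-Reasoning

  ∼-suffix : (q : Word r) {u v : Word r} → u ∼ v → (u ++ q) ∼ (v ++ q)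
  ∼-suffix q {u} {v} (mk∼ e) = mk∼ (resp (≈sym cancelSuffix) e)
    where
    cancelSuffix : ((u ++ q) ++ invW (v ++ q)) ≈F (u ++ invW v)
    cancelSuffix = begin
      (u ++ q) ++ invW (v ++ q)                ≡⟨ cong ((u ++ q) ++_) (invW-++ v q) ⟩
      (u ++ q) ++ invW q ++ invW v             ≡⟨ solve (++-monoid (Letter r)) ⟩
      u ++ (q ++ invW q) ++ invW v             ≈⟨ ≈F-prefix u (≈F-suffix (invW v) (invW-cancelʳ q)) ⟩
      u ++ invW v                              ∎
      where open ≈F-Reasoning r

  ∼-++ : {u v u′ v′ : Word r} → u ∼ v → u′ ∼ v′ → (u ++ u′) ∼ (v ++ v′)
  ∼-++ {v = v} {u′ = u′} e f = ∼-trans (∼-suffix u′ e) (∼-prefix v f)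

  member⇒∼[] : {u : Word r} → N u → u ∼ []
  member⇒∼[] {u} x = mk∼ (subst N (sym (++-identityʳ u)) x)

  ∼[]⇒member : {u : Word r} → u ∼ [] → N u
  ∼[]⇒member {u} (mk∼ x) = subst N (++-identityʳ u) x

  ∼-resp : {u v : Word r} → u ∼ v → N u → N v
  ∼-resp e x = ∼[]⇒member (∼-trans (∼-sym e) (member⇒∼[] x))

  ∼-cancelʳ : (u v : Word r) → (u ++ v) ∼ [] → u ∼ invW v
  ∼-cancelʳ u v e = begin
    u                        ≡⟨ ++-identityʳ u ⟨
    u ++ []                  ≈⟨ ≈F⇒∼ (≈F-prefix u (invW-cancelʳ v)) ⟨
    u ++ v ++ invW v         ≡⟨ ++-assoc u v (invW v) ⟨
    (u ++ v) ++ invW v       ≈⟨ ∼-suffix (invW v) e ⟩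
    invW v                   ∎
    where open ∼-Reasoning

  ∼-invW : {u v : Word r} → u ∼ v → invW u ∼ invW v
  ∼-invW {u} {v} e = ∼-cancelʳ (invW u) v
    (∼-trans (∼-prefix (invW u) (∼-sym e)) (≈F⇒∼ (invW-cancelˡ u)))

module _ {r : ℕ} where

  meetNormal : (A B : Word r → Set) → IsNormalSub A → IsNormalSub B → IsNormalSub (Meet A B)
  meetNormal A B nA nB = record
    { resp = λ e x → A.resp e (proj₁ x) , B.resp e (proj₂ x)
    ; nil  = A.nil , B.nil
    ; mul  = λ x y → A.mul (proj₁ x) (proj₁ y) , B.mul (proj₂ x) (proj₂ y)
    ; inv  = λ x → A.inv (proj₁ x) , B.inv (proj₂ x)
    ; conj = λ g x → A.conj g (proj₁ x) , B.conj g (proj₂ x) }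
    where
    module A = IsNormalSub nA
    module B = IsNormalSub nB

  prod-left : {A B : Word r → Set} {w : Word r} → B [] → A w → Prod A B w
  prod-left {w = w} b₀ a = w , [] , a , b₀ , ≡⇒≈F (sym (++-identityʳ w))

  prod-right : {A B : Word r → Set} {w : Word r} → A [] → B w → Prod A B w
  prod-right {w = w} a₀ b = [] , w , a₀ , b , ≈refl

  -- AB is a subgroup because B is normal: (ab)(a′b′) = (a·ba′b⁻¹)(bb′),
  -- (ab)⁻¹ = (b⁻¹a⁻¹b)b⁻¹, and g(ab)g⁻¹ = (gag⁻¹)(gbg⁻¹)
  prodNormal : (A B : Word r → Set) → IsNormalSub A → IsNormalSub B → IsNormalSub (Prod A B)
  prodNormal A B nA nB = record
    { resp = λ { e (a , b , x , y , f) → a , b , x , y , ≈trans (≈sym e) f }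
    ; nil  = [] , [] , A.nil , B.nil , ≈refl
    ; mul  = mul′
    ; inv  = inv′
    ; conj = conj′ }
    where
    module A = IsNormalSub nA
    module B = IsNormalSub nB
    open ≈F-Reasoning r

    mul′ : ∀ {u v} → Prod A B u → Prod A B v → Prod A B (u ++ v)
    mul′ {u} {v} (a , b , x , y , f) (a′ , b′ , x′ , y′ , f′) =
      a ++ (b ++ a′ ++ invW b) , b ++ b′ , A.mul x (A.conj b x′) , B.mul y y′ , regroup
      where
      regroup : (u ++ v) ≈F ((a ++ (b ++ a′ ++ invW b)) ++ (b ++ b′))
      regroup = begin
        u ++ v                                    ≈⟨ ≈F-++ f f′ ⟩
        (a ++ b) ++ (a′ ++ b′)                    ≡⟨ solve (++-monoid (Letter r)) ⟩
        (a ++ b ++ a′) ++ b′                      ≈⟨ ≈F-insert (a ++ b ++ a′) b b′ ⟩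
        (a ++ b ++ a′) ++ (invW b ++ b) ++ b′     ≡⟨ solve (++-monoid (Letter r)) ⟩
        (a ++ (b ++ a′ ++ invW b)) ++ (b ++ b′)   ∎

    inv′ : ∀ {u} → Prod A B u → Prod A B (invW u)
    inv′ {u} (a , b , x , y , f) =
      invW b ++ invW a ++ invW (invW b) , invW b , A.conj (invW b) (A.inv x) , B.inv y , regroup
      where
      regroup : invW u ≈F ((invW b ++ invW a ++ invW (invW b)) ++ invW b)
      regroup = begin
        invW u                                                ≈⟨ ≈F-invW f ⟩
        invW (a ++ b)                                         ≡⟨ invW-++ a b ⟩
        invW b ++ invW a                                      ≡⟨ ++-identityʳ _ ⟨
        (invW b ++ invW a) ++ []                              ≈⟨ ≈F-insert (invW b ++ invW a) (invW b) [] ⟩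
        (invW b ++ invW a) ++ (invW (invW b) ++ invW b) ++ [] ≡⟨ solve (++-monoid (Letter r)) ⟩
        (invW b ++ invW a ++ invW (invW b)) ++ invW b         ∎

    conj′ : ∀ g {u} → Prod A B u → Prod A B (g ++ u ++ invW g)
    conj′ g {u} (a , b , x , y , f) =
      g ++ a ++ invW g , g ++ b ++ invW g , A.conj g x , B.conj g y , regroup
      where
      regroup : (g ++ u ++ invW g) ≈F ((g ++ a ++ invW g) ++ (g ++ b ++ invW g))
      regroup = begin
        g ++ u ++ invW g                                ≈⟨ ≈F-prefix g (≈F-suffix (invW g) f) ⟩
        g ++ (a ++ b) ++ invW g                         ≡⟨ solve (++-monoid (Letter r)) ⟩
        (g ++ a) ++ b ++ invW g                         ≈⟨ ≈F-insert (g ++ a) g (b ++ invW g) ⟩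
        (g ++ a) ++ (invW g ++ g) ++ b ++ invW g        ≡⟨ solve (++-monoid (Letter r)) ⟩
        (g ++ a ++ invW g) ++ (g ++ b ++ invW g)        ∎

  barW-++ : (u v : Word r) → barW (u ++ v) ≡ barW u ++ barW v
  barW-++ = concatMap-++ barL

  barL-invL : (x : Letter r) → barL (invL x) ≡ invW (barL x)
  barL-invL (k , true)  = refl
  barL-invL (k , false) = sym (invW-involutive (barPos k))

  barW-invW : (u : Word r) → barW (invW u) ≡ invW (barW u)
  barW-invW []      = refl
  barW-invW (x ∷ u) = begin
    barW (invW (x ∷ u))                 ≡⟨ cong barW (invW-++ [ x ] u) ⟩
    barW (invW u ++ [ invL x ])         ≡⟨ barW-++ (invW u) [ invL x ] ⟩
    barW (invW u) ++ barL (invL x) ++ [] ≡⟨ cong₂ _++_ (barW-invW u)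
                                                       (trans (++-identityʳ _) (barL-invL x)) ⟩
    invW (barW u) ++ invW (barL x)      ≡⟨ invW-++ (barL x) (barW u) ⟨
    invW (barW (x ∷ u))                 ∎
    where open ≡-Reasoning

  barW-resp : {u v : Word r} → u ≈F v → barW u ≈F barW v
  barW-resp ≈refl           = ≈refl
  barW-resp (≈sym e)        = ≈sym (barW-resp e)
  barW-resp (≈trans e f)    = ≈trans (barW-resp e) (barW-resp f)
  barW-resp (≈cancel u x v) = begin
    barW (u ++ x ∷ invL x ∷ v)                     ≡⟨ barW-++ u (x ∷ invL x ∷ v) ⟩
    barW u ++ barL x ++ barL (invL x) ++ barW v     ≡⟨ cong (λ z → barW u ++ barL x ++ z ++ barW v)
                                                            (barL-invL x) ⟩
    barW u ++ barL x ++ invW (barL x) ++ barW v     ≡⟨ solve (++-monoid (Letter r)) ⟩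
    barW u ++ (barL x ++ invW (barL x)) ++ barW v   ≈⟨ ≈F-prefix (barW u)
                                                         (≈F-suffix (barW v) (invW-cancelʳ (barL x))) ⟩
    barW u ++ barW v                                ≡⟨ barW-++ u v ⟨
    barW (u ++ v)                                   ∎
    where open ≈F-Reasoning r

  barNormal : (A : Word r → Set) → IsNormalSub A → IsNormalSub (Bar A)
  barNormal A nA = record
    { resp = λ e → A.resp (barW-resp e)
    ; nil  = A.nil
    ; mul  = λ {u} {v} x y → subst A (sym (barW-++ u v)) (A.mul x y)
    ; inv  = λ {u} x → subst A (sym (barW-invW u)) (A.inv x)
    ; conj = λ g {u} x → subst A (sym (barConj g u)) (A.conj (barW g) x) }
    where
    module A = IsNormalSub nA
    barConj : (g u : Word r) → barW (g ++ u ++ invW g) ≡ barW g ++ barW u ++ invW (barW g)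
    barConj g u = begin
      barW (g ++ u ++ invW g)              ≡⟨ barW-++ g (u ++ invW g) ⟩
      barW g ++ barW (u ++ invW g)         ≡⟨ cong (barW g ++_) (barW-++ u (invW g)) ⟩
      barW g ++ barW u ++ barW (invW g)    ≡⟨ cong (λ z → barW g ++ barW u ++ z) (barW-invW g) ⟩
      barW g ++ barW u ++ invW (barW g)    ∎
      where open ≡-Reasoning

InRange : ∀ {r} → ℕ → ℕ → Fin r → Set
InRange lo hi k = lo ≤ toℕ k × toℕ k < hi

inRange? : ∀ {r} (lo hi : ℕ) (k : Fin r) → Dec (InRange lo hi k)
inRange? lo hi k = (lo ≤? toℕ k) ×-dec (toℕ k <? hi)

selected : (r : ℕ) → ℕ → ℕ → List (Fin r)
selected r lo hi = filter (inRange? lo hi) (allFin r)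

filter-shift : ∀ {r m} lo hi (g : Fin m → Fin r) →
  filter (inRange? (suc lo) (suc hi)) (tabulate (suc ∘ g)) ≡ map suc (filter (inRange? lo hi) (tabulate g))
filter-shift {m = zero}  lo hi g = refl
filter-shift {r} {suc m} lo hi g with inRange? lo hi (g zero)
... | yes (p , q) = begin
  filter P′ (suc (g zero) ∷ tabulate (suc ∘ g ∘ suc))  ≡⟨ filter-accept P′ (s≤s p , s≤s q) ⟩
  suc (g zero) ∷ filter P′ (tabulate (suc ∘ g ∘ suc))  ≡⟨ cong (suc (g zero) ∷_) (filter-shift lo hi (g ∘ suc)) ⟩
  map suc (g zero ∷ filter P (tabulate (g ∘ suc)))    ≡⟨ cong (map suc) (filter-accept P (p , q)) ⟨
  map suc (filter P (g zero ∷ tabulate (g ∘ suc)))    ∎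
  where
  open ≡-Reasoning
  P : (k : Fin r) → Dec (InRange lo hi k)
  P = inRange? lo hi
  P′ : (k : Fin (suc r)) → Dec (InRange (suc lo) (suc hi) k)
  P′ = inRange? (suc lo) (suc hi)
... | no ¬pq = begin
  filter P′ (suc (g zero) ∷ tabulate (suc ∘ g ∘ suc))  ≡⟨ filter-reject P′ {x = suc (g zero)}
                                                            (λ { (s≤s p , s≤s q) → ¬pq (p , q) }) ⟩
  filter P′ (tabulate (suc ∘ g ∘ suc))                 ≡⟨ filter-shift lo hi (g ∘ suc) ⟩
  map suc (filter P (tabulate (g ∘ suc)))              ≡⟨ cong (map suc) (filter-reject P {x = g zero} ¬pq) ⟨
  map suc (filter P (g zero ∷ tabulate (g ∘ suc)))     ∎
  where
  open ≡-Reasoning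
  P : (k : Fin r) → Dec (InRange lo hi k)
  P = inRange? lo hi
  P′ : (k : Fin (suc r)) → Dec (InRange (suc lo) (suc hi) k)
  P′ = inRange? (suc lo) (suc hi)

selected-shift : ∀ r lo hi → selected (suc r) (suc lo) (suc hi) ≡ map suc (selected r lo hi)
selected-shift r lo hi = filter-shift lo hi (λ k → k)

selected-0-1 : ∀ r → selected (suc r) 0 1 ≡ [ zero ]
selected-0-1 r =
  cong (zero ∷_) (filter-none (inRange? 0 1) (tabulate⁺ {n = r} {f = suc} λ { _ (_ , s≤s ()) }))

selected-0-2 : ∀ r → selected (suc (suc r)) 0 2 ≡ zero ∷ suc zero ∷ []
selected-0-2 r =
  cong (λ z → zero ∷ suc zero ∷ z)
       (filter-none (inRange? 0 2) (tabulate⁺ {n = r} {f = λ k → suc (suc k)} λ { _ (_ , s≤s (s≤s ())) }))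

selected-single : ∀ r (k : Fin r) → selected r (toℕ k) (suc (toℕ k)) ≡ [ k ]
selected-single (suc r) zero    = selected-0-1 r
selected-single (suc r) (suc k) =
  trans (selected-shift r (toℕ k) (suc (toℕ k))) (cong (map suc) (selected-single r k))

selected-pair : ∀ r (j : Fin (suc r)) →
  selected (suc (suc r)) (toℕ j) (suc (suc (toℕ j))) ≡ inject₁ j ∷ suc j ∷ []
selected-pair r       zero    = selected-0-2 r
selected-pair (suc r) (suc j) =
  trans (selected-shift (suc (suc r)) (toℕ j) (suc (suc (toℕ j)))) (cong (map suc) (selected-pair r j))

range-single : ∀ r (k : Fin r) → range {r} (toℕ k) (suc (toℕ k)) ≡ [ (k , true) ]
range-single r k = cong (map (λ k → k , true)) (selected-single r k)

range-pair : ∀ r (j : Fin (suc r)) →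
  range {suc (suc r)} (toℕ j) (suc (suc (toℕ j))) ≡ (inject₁ j , true) ∷ (suc j , true) ∷ []
range-pair r j = cong (map (λ k → k , true)) (selected-pair r j)

MaximalNormal : ∀ {r} → (Word r → Set) → Set₁
MaximalNormal {r} K =
  ∀ (L : Word r → Set) → IsNormalSub L → (∀ w → K w → L w) → (∀ w → L w → K w) ⊎ (∀ w → L w)

Abelian : ∀ {r} → (Word r → Set) → Set
Abelian K = ∀ x y → K ((x ++ y) ++ invW (y ++ x))

module AbelianQuotient {r : ℕ} (K : Word r → Set) (nK : IsNormalSub K)
  (maximal : MaximalNormal K) (abelian : Abelian K) where

  open IsNormalSub nK
  open Modulo K nK

  comm : (x y : Word r) → (x ++ y) ∼ (y ++ x)
  comm x y = mk∼ (abelian x y)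

  conj-trivial : (g x : Word r) → (g ++ x ++ invW g) ∼ x
  conj-trivial g x = begin
    g ++ x ++ invW g           ≈⟨ comm g (x ++ invW g) ⟩
    (x ++ invW g) ++ g         ≡⟨ solve (++-monoid (Letter r)) ⟩
    x ++ (invW g ++ g) ++ []   ≈⟨ ≈F⇒∼ (≈F-insert x g []) ⟨
    x ++ []                    ≡⟨ ++-identityʳ x ⟩
    x                          ∎
    where open ∼-Reasoning

  -- Let c = ab satisfy c² = 1.  If the only elements a shares with b (up to
  -- the square relation a² = b⁻²) or with c are trivial, then a = 1: first
  -- a²b² = c² = 1 gives a² = 1, so K ∪ aK is a normal subgroup above K; it is
  -- not everything, since b ∈ K would give a = c and b ∈ aK would give a = b.
  trivialGenerator : (a b : Word r) → K ((a ++ b) ++ (a ++ b)) →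
    ((a ++ a) ∼ (invW b ++ invW b) → K (a ++ a)) →
    (a ∼ b → K a) → (a ∼ (a ++ b) → K a) → K a
  trivialGenerator a b c² a∩b² a∩b a∩c = aTrivial
    where
    squares : ((a ++ b) ++ (a ++ b)) ∼ ((a ++ a) ++ (b ++ b))
    squares = begin
      (a ++ b) ++ (a ++ b)    ≡⟨ solve (++-monoid (Letter r)) ⟩
      a ++ (b ++ a) ++ b      ≈⟨ ∼-prefix a (∼-suffix b (comm b a)) ⟩
      a ++ (a ++ b) ++ b      ≡⟨ solve (++-monoid (Letter r)) ⟩
      (a ++ a) ++ (b ++ b)    ∎
      where open ∼-Reasoning

    a²∈K : K (a ++ a)
    a²∈K = a∩b² (∼-trans (∼-cancelʳ (a ++ a) (b ++ b) (∼-trans (∼-sym squares) (member⇒∼[] c²)))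
                        (≡⇒∼ (invW-++ b b)))

    a⁻¹∼a : invW a ∼ a
    a⁻¹∼a = ∼-sym (∼-cancelʳ a a (member⇒∼[] a²∈K))

    L : Word r → Set
    L x = K x ⊎ x ∼ a

    L-resp : ∀ {x y} → x ∼ y → L x → L y
    L-resp e (inj₁ k) = inj₁ (∼-resp e k)
    L-resp e (inj₂ f) = inj₂ (∼-trans (∼-sym e) f)

    L-mul : ∀ {x y} → L x → L y → L (x ++ y)
    L-mul (inj₁ k) (inj₁ k′) = inj₁ (mul k k′)
    L-mul (inj₁ k) (inj₂ f)  = inj₂ (∼-++ (member⇒∼[] k) f)
    L-mul (inj₂ f) (inj₁ k)  = inj₂ (∼-trans (∼-++ f (member⇒∼[] k)) (≡⇒∼ (++-identityʳ a)))
    L-mul (inj₂ f) (inj₂ f′) = inj₁ (∼[]⇒member (∼-trans (∼-++ f f′) (member⇒∼[] a²∈K)))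

    L-inv : ∀ {x} → L x → L (invW x)
    L-inv (inj₁ k) = inj₁ (inv k)
    L-inv (inj₂ f) = inj₂ (∼-trans (∼-invW f) a⁻¹∼a)

    L-normal : IsNormalSub L
    L-normal = record
      { resp = λ e → L-resp (≈F⇒∼ e) ; nil = inj₁ nil ; mul = L-mul ; inv = L-inv
      ; conj = λ g {u} → L-resp (∼-sym (conj-trivial g u)) }

    aTrivial : K a
    aTrivial with maximal L L-normal (λ _ → inj₁)
    ... | inj₁ L⊆K = L⊆K a (inj₂ ∼-refl)
    ... | inj₂ L-all with L-all b
    ...   | inj₁ b∈K = a∩c (∼-trans (≡⇒∼ (sym (++-identityʳ a))) (∼-prefix a (∼-sym (member⇒∼[] b∈K))))
    ...   | inj₂ b∼a = a∩b (∼-sym b∼a)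

pair : ∀ {n} → Fin n → Fin n → Subset n
pair s t = ⁅ s ⁆ ∪ ⁅ t ⁆

∈pair-first : ∀ {n} (s t : Fin n) → s ∈ pair s t
∈pair-first s t = x∈p∪q⁺ (inj₁ (x∈⁅x⁆ s))

∈pair-second : ∀ {n} (s t : Fin n) → t ∈ pair s t
∈pair-second s t = x∈p∪q⁺ (inj₂ (x∈⁅x⁆ t))

∈pair⁻ : ∀ {n} {x : Fin n} (s t : Fin n) → x ∈ pair s t → x ≡ s ⊎ x ≡ t
∈pair⁻ s t x∈ with x∈p∪q⁻ ⁅ s ⁆ ⁅ t ⁆ x∈
... | inj₁ x∈s = inj₁ (x∈⁅y⁆⇒x≡y s x∈s)
... | inj₂ x∈t = inj₂ (x∈⁅y⁆⇒x≡y t x∈t)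

sharedIndex : ∀ {n} {x : Fin n} (s t u : Fin n) → toℕ t ≢ toℕ u →
  x ∈ pair s t ∩ pair s u → toℕ x ≡ toℕ s
sharedIndex s t u t≢u x∈ with x∈p∩q⁻ (pair s t) (pair s u) x∈
... | x∈st , x∈su with ∈pair⁻ s t x∈st | ∈pair⁻ s u x∈su
...   | inj₁ refl | _         = refl
...   | inj₂ _    | inj₁ refl = refl
...   | inj₂ refl | inj₂ x≡u  = ⊥-elim (t≢u (cong toℕ x≡u))

module IntersectionConsequences {r : ℕ} (K : Word r → Set) (nK : IsNormalSub K)
  (ip : IntersectionProperty K) where

  open Modulo K nK

  singletonGen-trivial : ∀ {w} (I : Subset (suc r)) (n : ℕ) →
    (∀ x → x ∈ I → toℕ x ≡ n) → InGen K I w → K w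
  singletonGen-trivial {w} I n single ([] , [] , e) = subst K (++-identityʳ w) e
  singletonGen-trivial I n single (_ ∷ _ , (i∈ , j∈ , i<j) ∷ _ , _) =
    ⊥-elim (<-irrefl (trans (single _ i∈) (sym (single _ j∈))) i<j)

  pairMeet-trivial : ∀ {w} (s t u : Fin (suc r)) → toℕ t ≢ toℕ u →
    InGen K (pair s t) w → InGen K (pair s u) w → K w
  pairMeet-trivial {w} s t u t≢u g₁ g₂ =
    singletonGen-trivial (pair s t ∩ pair s u) (toℕ s) (λ x → sharedIndex s t u t≢u)
      (ip (pair s t) (pair s u) w g₁ g₂)

  powers : Fin (suc r) → Fin (suc r) → List Bool → List (TauLetter r)
  powers p q = map (λ e → p , q , e)

  powers-in-Gen : ∀ {w} (I : Subset (suc r)) {p q : Fin (suc r)} → p ∈ I → q ∈ I → toℕ p < toℕ q →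
    (es : List Bool) → w ∼ expandTau (powers p q es) → InGen K I w
  powers-in-Gen I {p} {q} p∈ q∈ p<q es e =
    powers p q es , map⁺ (universal (λ _ → p∈ , q∈ , p<q) es) , witness e

  signed : Bool → Word r → Word r
  signed e t = if e then t else invW t

  as-power¹ : ∀ {w t} (p q : Fin (suc r)) → tau p q ≡ t → (e : Bool) →
    w ∼ signed e t → w ∼ expandTau (powers p q (e ∷ []))
  as-power¹ p q refl e w∼ = ∼-trans w∼ (≡⇒∼ (sym (++-identityʳ (signed e (tau p q)))))

  as-power² : ∀ {w t} (p q : Fin (suc r)) → tau p q ≡ t → (e : Bool) →
    w ∼ (signed e t ++ signed e t) → w ∼ expandTau (powers p q (e ∷ e ∷ []))
  as-power² p q refl e w∼ =
    ∼-trans w∼ (≡⇒∼ (cong (signed e (tau p q) ++_) (sym (++-identityʳ (signed e (tau p q))))))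

-- The generators
-- a = σⱼ₊₁ and b = σⱼ₊₂ with c = ab = τ_{j,j+2} satisfy c² = 1, and the
-- cyclic groups ⟨a⟩ = Γ_{j,j+1}, ⟨b⟩ = Γ_{j+1,j+2}, ⟨c⟩ = Γ_{j,j+2} meet
-- pairwise trivially, so trivialGenerator applies to (a, b) and to (b, a).

module ConsecutiveGenerators (r : ℕ) (K : Word (suc (suc r)) → Set) (nK : IsNormalSub K)
  (maximal : MaximalNormal K) (abelian : Abelian K)
  (ip : IntersectionProperty K) (relators : ContainsRelators K) (j : Fin (suc r)) where

  open Modulo K nK
  open AbelianQuotient K nK maximal abelian
  open IntersectionConsequences K nK ip

  m : ℕ
  m = toℕ j

  a b c : Word (suc (suc r))
  a = [ (inject₁ j , true) ]
  b = [ (suc j , true) ]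
  c = a ++ b

  T₀ T₁ T₂ : Fin (suc (suc (suc r)))
  T₀ = inject₁ (inject₁ j)
  T₁ = suc (inject₁ j)
  T₂ = suc (suc j)

  toℕ-T₀ : toℕ T₀ ≡ m
  toℕ-T₀ = trans (toℕ-inject₁ (inject₁ j)) (toℕ-inject₁ j)

  toℕ-T₁ : toℕ T₁ ≡ suc m
  toℕ-T₁ = cong suc (toℕ-inject₁ j)

  T₀<T₁ : toℕ T₀ < toℕ T₁
  T₀<T₁ = subst₂ _<_ (sym toℕ-T₀) (sym toℕ-T₁) (n<1+n m)

  T₁<T₂ : toℕ T₁ < toℕ T₂
  T₁<T₂ = subst (_< suc (suc m)) (sym toℕ-T₁) (n<1+n (suc m))

  T₀<T₂ : toℕ T₀ < toℕ T₂
  T₀<T₂ = <-trans T₀<T₁ T₁<T₂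

  τ₀₁ : tau T₀ T₁ ≡ a
  τ₀₁ = trans (cong (λ n → range n (suc (toℕ (inject₁ j)))) (toℕ-inject₁ (inject₁ j)))
              (range-single _ (inject₁ j))

  τ₁₂ : tau T₁ T₂ ≡ b
  τ₁₂ = trans (cong (λ n → range (suc n) (suc (suc m))) (toℕ-inject₁ j)) (range-single _ (suc j))

  τ₀₂ : tau T₀ T₂ ≡ c
  τ₀₂ = trans (cong (λ n → range n (suc (suc m))) toℕ-T₀) (range-pair r j)

  c²∈K : K (c ++ c)
  c²∈K = subst K (cong (λ w → w ++ w) σσ≡c) (relators (inject₁ j) (suc j) a<b)
    where
    σσ≡c : range (toℕ (inject₁ j)) (suc (suc m)) ≡ c
    σσ≡c = trans (cong (λ n → range n (suc (suc m))) (toℕ-inject₁ j)) (range-pair r j)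
    a<b : toℕ (inject₁ j) < suc m
    a<b = subst (_< suc m) (sym (toℕ-inject₁ j)) (n<1+n m)

  -- ⟨a⟩ ∩ ⟨b⟩, ⟨a⟩ ∩ ⟨c⟩ and ⟨b⟩ ∩ ⟨c⟩ are trivial: the index pairs
  -- {j,j+1}, {j+1,j+2}, {j,j+2} meet pairwise in a single index
  a∩b : ∀ {w} es es′ → w ∼ expandTau (powers T₀ T₁ es) → w ∼ expandTau (powers T₁ T₂ es′) → K w
  a∩b es es′ w∈a w∈b = pairMeet-trivial T₁ T₀ T₂ (<⇒≢ T₀<T₂)
    (powers-in-Gen (pair T₁ T₀) (∈pair-second T₁ T₀) (∈pair-first T₁ T₀) T₀<T₁ es w∈a)
    (powers-in-Gen (pair T₁ T₂) (∈pair-first T₁ T₂) (∈pair-second T₁ T₂) T₁<T₂ es′ w∈b)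

  a∩c : ∀ {w} es es′ → w ∼ expandTau (powers T₀ T₁ es) → w ∼ expandTau (powers T₀ T₂ es′) → K w
  a∩c es es′ w∈a w∈c = pairMeet-trivial T₀ T₁ T₂ (<⇒≢ T₁<T₂)
    (powers-in-Gen (pair T₀ T₁) (∈pair-first T₀ T₁) (∈pair-second T₀ T₁) T₀<T₁ es w∈a)
    (powers-in-Gen (pair T₀ T₂) (∈pair-first T₀ T₂) (∈pair-second T₀ T₂) T₀<T₂ es′ w∈c)

  b∩c : ∀ {w} es es′ → w ∼ expandTau (powers T₁ T₂ es) → w ∼ expandTau (powers T₀ T₂ es′) → K w
  b∩c es es′ w∈b w∈c = pairMeet-trivial T₂ T₁ T₀ (≢-sym (<⇒≢ T₀<T₁))
    (powers-in-Gen (pair T₂ T₁) (∈pair-second T₂ T₁) (∈pair-first T₂ T₁) T₁<T₂ es w∈b)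
    (powers-in-Gen (pair T₂ T₀) (∈pair-second T₂ T₀) (∈pair-first T₂ T₀) T₀<T₂ es′ w∈c)

  -- the three hypotheses of trivialGenerator each exhibit a word in two of
  -- the cyclic subgroups ⟨a⟩, ⟨b⟩, ⟨c⟩
  a∈K : K a
  a∈K = trivialGenerator a b c²∈K
    (λ a²∼b⁻² → a∩b (true ∷ true ∷ []) (false ∷ false ∷ [])
                    (as-power² T₀ T₁ τ₀₁ true ∼-refl) (as-power² T₁ T₂ τ₁₂ false a²∼b⁻²))
    (λ a∼b → a∩b (true ∷ []) (true ∷ [])
                 (as-power¹ T₀ T₁ τ₀₁ true ∼-refl) (as-power¹ T₁ T₂ τ₁₂ true a∼b))
    (λ a∼c → a∩c (true ∷ []) (true ∷ [])
                 (as-power¹ T₀ T₁ τ₀₁ true ∼-refl) (as-power¹ T₀ T₂ τ₀₂ true a∼c))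

  -- the same with the roles of a and b exchanged, using ba ∼ ab = c
  b∈K : K b
  b∈K = trivialGenerator b a (∼-resp (∼-++ (comm a b) (comm a b)) c²∈K)
    (λ b²∼a⁻² → a∩b (false ∷ false ∷ []) (true ∷ true ∷ [])
                    (as-power² T₀ T₁ τ₀₁ false b²∼a⁻²) (as-power² T₁ T₂ τ₁₂ true ∼-refl))
    (λ b∼a → a∩b (true ∷ []) (true ∷ [])
                 (as-power¹ T₀ T₁ τ₀₁ true b∼a) (as-power¹ T₁ T₂ τ₁₂ true ∼-refl))
    (λ b∼ba → b∩c (true ∷ []) (true ∷ [])
                  (as-power¹ T₁ T₂ τ₁₂ true ∼-refl) (as-power¹ T₀ T₂ τ₀₂ true (∼-trans b∼ba (comm b a))))

abelianQuotient-trivial : ∀ r (K : Word (suc (suc r)) → Set) → IsNormalSub K → MaximalNormal K →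
  Abelian K → IntersectionProperty K → ContainsRelators K → ∀ w → K w
abelianQuotient-trivial r K nK maximal abelian ip relators = allInK
  where
  open IsNormalSub nK
  module Gen = ConsecutiveGenerators r K nK maximal abelian ip relators

  generator : ∀ k → K [ (k , true) ]
  generator zero    = Gen.a∈K zero
  generator (suc j) = Gen.b∈K j

  allInK : ∀ w → K w
  allInK []                = nil
  allInK ((k , true) ∷ w)  = mul (generator k) (allInK w)
  allInK ((k , false) ∷ w) = mul (inv (generator k)) (allInK w)

-- Rank 2: W⁺ is free on σ₁ alone and bar inverts σ₁, so every normal
-- subgroup is bar-invariant and no rotation subgroup is chiral.

letters-commute : (x y : Letter 1) → (x ∷ y ∷ []) ≈F (y ∷ x ∷ [])
letters-commute (zero , true)  (zero , true)  = ≈refl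
letters-commute (zero , false) (zero , false) = ≈refl
letters-commute (zero , true)  (zero , false) =
  ≈trans (≈cancel [] (zero , true) []) (≈sym (≈cancel [] (zero , false) []))
letters-commute (zero , false) (zero , true)  =
  ≈trans (≈cancel [] (zero , false) []) (≈sym (≈cancel [] (zero , true) []))

letter-central : (u : Word 1) (x : Letter 1) → (u ++ [ x ]) ≈F (x ∷ u)
letter-central []      x = ≈refl
letter-central (y ∷ u) x = ≈trans (≈F-prefix [ y ] (letter-central u x)) (≈F-suffix u (letters-commute y x))

reverse-free : (u : Word 1) → reverse u ≈F u
reverse-free []      = ≈refl
reverse-free (x ∷ u) =
  ≈trans (≡⇒≈F (unfold-reverse x u)) (≈trans (≈F-suffix [ x ] (reverse-free u)) (letter-central u x))

-- bar inverts each letter, so barW u is the reverse of u⁻¹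
barW-rank2 : (u : Word 1) → barW u ≡ map invL u
barW-rank2 []                  = refl
barW-rank2 ((zero , true) ∷ u)  = cong ((zero , false) ∷_) (barW-rank2 u)
barW-rank2 ((zero , false) ∷ u) = cong ((zero , true) ∷_) (barW-rank2 u)

barW≈invW-rank2 : (u : Word 1) → barW u ≈F invW u
barW≈invW-rank2 u = ≈trans (≡⇒≈F (barW-rank2 u)) (≈sym (reverse-free (map invL u)))

barInvariant-rank2 : (N : Word 1 → Set) → IsNormalSub N → BarInvariant N
barInvariant-rank2 N nN w =
  (λ w∈N → resp (≈sym (barW≈invW-rank2 w)) (inv w∈N)) ,
  (λ w̄∈N → subst N (invW-involutive w) (inv (resp (barW≈invW-rank2 w) w̄∈N)))
  where open IsNormalSub nN

-- A simple W⁺/K satisfying the intersection property is never abelian,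
-- as long as some rotation subgroup N is chiral: rank 1 has W⁺ trivial,
-- rank 2 has no chiral N, and rank ≥ 3 is abelianQuotient-trivial.

simpleQuotient-nonabelian : ∀ r (N K : Word r → Set) → IsNormalSub N → ¬ BarInvariant N →
  IsNormalSub K → SimpleQuot K → IntersectionProperty K → ContainsRelators K → ¬ Abelian K
simpleQuotient-nonabelian zero          N K nN chiral nK (proper , _) ip rel abelian =
  proper λ { [] → IsNormalSub.nil nK ; ((() , _) ∷ _) }
simpleQuotient-nonabelian (suc zero)    N K nN chiral nK simple ip rel abelian =
  chiral (barInvariant-rank2 N nN)
simpleQuotient-nonabelian (suc (suc r)) N K nN chiral nK (proper , maximal) ip rel abelian =
  proper (abelianQuotient-trivial r K nK maximal abelian ip rel)

module Mix {r : ℕ} (N K : Word r → Set) (nN : IsNormalSub N) (chiral : ¬ BarInvariant N)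
  (nK : IsNormalSub K) (barK : BarInvariant K) (simple : SimpleQuot K)
  (ipK : IntersectionProperty K) (relK : ContainsRelators K) where

  N̄ : Word r → Set
  N̄ = Bar N

  nN̄ : IsNormalSub N̄
  nN̄ = barNormal N nN

  private
    module N = IsNormalSub nN
    module N̄ = IsNormalSub nN̄
    module K = IsNormalSub nK
  open Modulo N nN using (_∼_; ∼-refl; ∼-sym; ∼-trans; ∼-suffix; ≈F⇒∼; member⇒∼[]; witness)
  module ModK = Modulo K nK

  productWithK : (A : Word r → Set) → IsNormalSub A → (∀ w → A w → K w) ⊎ (∀ w → Prod K A w)
  productWithK A nA
    with proj₂ simple (Prod K A) (prodNormal K A nK nA) (λ _ → prod-left (IsNormalSub.nil nA))
  ... | inj₁ KA⊆K = inj₁ (λ w a → KA⊆K w (prod-right K.nil a))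
  ... | inj₂ KA-all = inj₂ KA-all

  A-part : {A : Word r → Set} → ∀ {x} → Prod K A x → Σ (Word r) λ a → A a × x ModK.∼ a
  A-part (k , a , k∈K , a∈A , x≈ka) =
    a , a∈A , ModK.∼-trans (ModK.≈F⇒∼ x≈ka) (ModK.∼-suffix a (ModK.member⇒∼[] k∈K))

  -- [N, N̄] ⊆ N ∩ N̄, both being normal
  commutator-in-meet : ∀ {n m} → N n → N̄ m → Meet N N̄ ((n ++ m) ++ invW (m ++ n))
  commutator-in-meet {n} {m} n∈N m∈N̄ =
    subst N (sym (regroup (n ++ (m ++ invW n ++ invW m)) (solve (++-monoid (Letter r)))))
      (N.mul n∈N (N.conj m (N.inv n∈N))) ,
    subst N̄ (sym (regroup ((n ++ m ++ invW n) ++ invW m) (solve (++-monoid (Letter r)))))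
      (N̄.mul {n ++ m ++ invW n} {invW m} (N̄.conj n {m} m∈N̄) (N̄.inv {m} m∈N̄))
    where
    -- n m n⁻¹ m⁻¹, to be regrouped as n·(m n⁻¹ m⁻¹) and as (n m n⁻¹)·m⁻¹
    regroup : (z : Word r) → (n ++ m) ++ invW n ++ invW m ≡ z → (n ++ m) ++ invW (m ++ n) ≡ z
    regroup z eq = trans (cong ((n ++ m) ++_) (invW-++ m n)) eq

  -- if KN = KN̄ = W⁺ and N ∩ N̄ ⊆ K then W⁺/K is abelian:
  -- xy ∼ nm ∼ mn ∼ yx with x ∼ n ∈ N and y ∼ m ∈ N̄
  abelianQuotient : (∀ w → Prod K N w) → (∀ w → Prod K N̄ w) → (∀ w → Meet N N̄ w → K w) → Abelian K
  abelianQuotient KN KN̄ N∩N̄⊆K x y with A-part (KN x) | A-part (KN̄ y)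
  ... | n , n∈N , x∼n | m , m∈N̄ , y∼m = ModK.witness (begin
    x ++ y    ≈⟨ ModK.∼-++ x∼n y∼m ⟩
    n ++ m    ≈⟨ ModK.mk∼ (N∩N̄⊆K _ (commutator-in-meet n∈N m∈N̄)) ⟩
    m ++ n    ≈⟨ ModK.∼-++ y∼m x∼n ⟨
    y ++ x    ∎)
    where open ModK.∼-Reasoning

  -- If N ⊆ K or
  -- N̄ ⊆ K take c = b; N ∩ N̄ ⊆ K (with KN = KN̄ = W⁺) would make W⁺/K abelian;
  -- otherwise b = km with m ∈ N ∩ N̄, and c = m⁻¹b.
  barRepresentative : ∀ b → N̄ b → Σ (Word r) λ c → (N̄ c × K c) × c ∼ b
  barRepresentative b b∈N̄ with productWithK N nN
  ... | inj₁ N⊆K = b , (b∈N̄ , proj₂ (barK b) (N⊆K (barW b) b∈N̄)) , ∼-refl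
  ... | inj₂ KN with productWithK N̄ nN̄
  ...   | inj₁ N̄⊆K = b , (b∈N̄ , N̄⊆K b b∈N̄) , ∼-refl
  ...   | inj₂ KN̄ with productWithK (Meet N N̄) (meetNormal N N̄ nN nN̄)
  ...     | inj₁ N∩N̄⊆K =
    ⊥-elim (simpleQuotient-nonabelian r N K nN chiral nK simple ipK relK
              (abelianQuotient KN KN̄ N∩N̄⊆K))
  ...     | inj₂ KM with KM b
  ...       | k , m , k∈K , (m∈N , m∈N̄) , b≈km =
    invW m ++ b , (N̄.mul {invW m} {b} (N̄.inv {m} m∈N̄) b∈N̄ , c∈K) ,
    ∼-suffix b (member⇒∼[] (N.inv m∈N))
    where
    -- c = m⁻¹b ≈ m⁻¹km, a conjugate of k
    c∈K : K (invW m ++ b)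
    c∈K = K.resp (≈sym (≈F-prefix (invW m) b≈km))
            (subst (λ z → K (invW m ++ k ++ z)) (invW-involutive m) (K.conj (invW m) k∈K))

  -- injectivity: X(P ◇ Q) ⊆ K, since K is bar-invariant
  mixChirality⊆K : ∀ {w} → ChiralityGroup (Meet N K) w → K w
  mixChirality⊆K (a , b , (_ , a∈K) , (_ , b̄∈K) , w≈ab) =
    K.resp (≈sym w≈ab) (K.mul a∈K (proj₂ (barK b) b̄∈K))

  -- surjectivity: each w = ab ∈ X(P) is congruent mod N to b, hence to the c ∈ N̄ ∩ K
  -- of the key lemma, and c ∈ (N ∩ K)(N̄ ∩ K)
  chirality-covered : ∀ w → ChiralityGroup N w →
    Σ (Word r) λ v → ChiralityGroup (Meet N K) v × (v ∼[ N ] w)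
  chirality-covered w (a , b , a∈N , b∈N̄ , w≈ab) with barRepresentative b b∈N̄
  ... | c , (c∈N̄ , c∈K) , c∼b =
    c , prod-right (N.nil , K.nil) (c∈N̄ , proj₁ (barK c) c∈K) ,
    witness (∼-trans c∼b (∼-trans (∼-sym (∼-suffix b (member⇒∼[] a∈N))) (≈F⇒∼ (≈sym w≈ab))))

-- X(P ◇ Q) → X(P) is injective (mixChirality⊆K) and onto (chirality-covered)
theorem4p8 : (r : ℕ) (N K : Word r → Set) →
    IsChiralRot N → FiniteQuot N →
    IsDirRegRot K → FiniteQuot K → SimpleQuot K →
    ¬ SubQuotIso (ChiralityGroup N) N (λ _ → ⊤) K →
    MixChiralityEq N K
theorem4p8 r N K ((nN , _) , _ , chiral) _ ((nK , relK) , ipK , barK) _ simpleK _ =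
  (λ w w∈X w∈N → w∈N , mixChirality⊆K w∈X) , chirality-covered
  where open Mix N K nN chiral nK barK simpleK ipK relK
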